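{- Let $\langle A;\cdot,0,\Diamond\rangle$ be a monadic quasi-implication algebra and let $\mathfrak{F}(A)$ be the set of proper filters of the bounded quasi-implication algebra $\langle A;\cdot,0\rangle$. Define $\alpha\perp^G_A\beta$ iff there exists $x\in A$ with $x\in\alpha$ and $x\cdot 0\in\beta$, and $\alpha R^G_A\beta$ iff $\Diamond[\alpha]\subseteq\beta$, where $\Diamond[\alpha]=\{\Diamond x: x\in\alpha\}$. Then $\langle\mathfrak{F}(A);\perp^G_A,R^G_A\rangle$ is a monadic orthoframe.
   Context: A quasi-implication algebra is a magma $\langle A;\cdot\rangle$ satisfying, for all $x,y,z$: (1) $(x\cdot y)\cdot x=x$; (2) $(x\cdot y)\cdot(x\cdot z)=(y\cdot x)\cdot(y\cdot z)$; (3) $((x\cdot y)\cdot(y\cdot x))\cdot x=((y\cdot x)\cdot(x\cdot y))\cdot y$. In any quasi-implication algebra $x\cdot x=y\cdot y$ for all $x,y$, and $1$ denotes this common element. A bounded quasi-implication algebra is a quasi-implication algebra with a distinguished element $0$ such that $0\cdot x=1$ for all $x$. A monadic quasi-implication algebra is an algebra $\langle A;\cdot,0,\Diamond\rangle$ such that $\langle A;\cdot,0\rangle$ is a bounded quasi-implication algebra and $\Diamond\colon A\to A$ satisfies, for all $x,y$: (a) $\Diamond\Diamond x\cdot\Diamond x=1$ and $x\cdot\Diamond x=1$; (b) $\Diamond(\Diamond x\cdot 0)=\Diamond x\cdot 0$ and $\Diamond 0=0$; (c) $\Diamond(((x\cdot 0)\cdot(y\cdot 0))\cdot x)=((\Diamond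 x\cdot 0)\cdot(\Diamond y\cdot 0))\cdot\Diamond x$. A filter of a bounded quasi-implication algebra $A$ is a non-empty subset $\alpha\subseteq A$ such that (i) if $x\in\alpha$ and $x\cdot y=1$ then $y\in\alpha$; (ii) if $x,y\in\alpha$ then $((x\cdot y)\cdot(x\cdot 0))\cdot 0\in\alpha$; it is proper if $0\notin\alpha$. For a relation $R$ on a set $X$ and $U\subseteq X$, $R[U]=\{y\in X: uRy\text{ for some }u\in U\}$; for a relation $\perp$ on $X$, $U^{\perp}=\{y\in X: y\perp u\text{ for all }u\in U\}$. A monadic orthoframe is a triple $\langle X;\perp,R\rangle$ where $\perp$ is an irreflexive symmetric relation on $X$, $R$ is a reflexive transitive relation on $X$, and $R[R[\{x\}]^{\perp}]\subseteq R[\{x\}]^{\perp}$ for all $x\in X$. -}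

module Defs where

open import Level using (Level; _⊔_; suc)
open import Relation.Binary.PropositionalEquality using (_≡_)
open import Data.Product using (Σ; ∃; _×_; _,_; proj₁)
open import Relation.Nullary using (¬_)
open import Relation.Unary using (Pred; _∈_; _⊆_)
open import Relation.Binary using (Rel)

record IsQIA {a} (A : Set a) (_·_ : A → A → A) : Set a where
  field
    ax1 : ∀ x y → (x · y) · x ≡ x
    ax2 : ∀ x y z → (x · y) · (x · z) ≡ (y · x) · (y · z)
    ax3 : ∀ x y → ((x · y) · (y · x)) · x ≡ ((y · x) · (x · y)) · y

-- 1 is x · x (independent of x in any QIA)
one : ∀ {a} {A : Set a} → (A → A → A) → A → A
one _·_ x = x · x

record IsBoundedQIA {a} (A : Set a) (_·_ : A → A → A) (𝟘 : A) : Set a where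
  field
    isQIA : IsQIA A _·_
    zero-imp : ∀ x → 𝟘 · x ≡ x · x

record IsMonadicQIA {a} (A : Set a) (_·_ : A → A → A) (𝟘 : A) (◇ : A → A) : Set a where
  field
    isBoundedQIA : IsBoundedQIA A _·_ 𝟘
    ma1 : ∀ x → ◇ (◇ x) · ◇ x ≡ x · x
    ma2 : ∀ x → x · ◇ x ≡ x · x
    mb1 : ∀ x → ◇ (◇ x · 𝟘) ≡ ◇ x · 𝟘
    mb2 : ◇ 𝟘 ≡ 𝟘
    mc  : ∀ x y → ◇ (((x · 𝟘) · (y · 𝟘)) · x) ≡ ((◇ x · 𝟘) · (◇ y · 𝟘)) · ◇ x

record IsFilter {a ℓ} {A : Set a} (_·_ : A → A → A) (𝟘 : A) (α : Pred A ℓ) : Set (a ⊔ ℓ) where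
  field
    nonempty : ∃ λ x → x ∈ α
    up : ∀ {x y} → x ∈ α → x · y ≡ y · y → y ∈ α
    meet : ∀ {x y} → x ∈ α → y ∈ α → ((x · y) · (x · 𝟘)) · 𝟘 ∈ α

record IsProperFilter {a ℓ} {A : Set a} (_·_ : A → A → A) (𝟘 : A) (α : Pred A ℓ) : Set (a ⊔ ℓ) where
  field
    isFilter : IsFilter _·_ 𝟘 α
    proper : ¬ (𝟘 ∈ α)

ProperFilters : ∀ {a} ℓ {A : Set a} → (A → A → A) → A → Set (a ⊔ suc ℓ)
ProperFilters ℓ {A} _·_ 𝟘 = Σ (Pred A ℓ) (IsProperFilter _·_ 𝟘)

⊥ᴳ : ∀ {a} ℓ {A : Set a} (_·_ : A → A → A) (𝟘 : A) → Rel (ProperFilters ℓ _·_ 𝟘) (a ⊔ ℓ)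
⊥ᴳ ℓ _·_ 𝟘 α β = ∃ λ x → x ∈ proj₁ α × (x · 𝟘) ∈ proj₁ β

Rᴳ : ∀ {a} ℓ {A : Set a} (_·_ : A → A → A) (𝟘 : A) (◇ : A → A) → Rel (ProperFilters ℓ _·_ 𝟘) (a ⊔ ℓ)
Rᴳ ℓ _·_ 𝟘 ◇ α β = ∀ {x} → x ∈ proj₁ α → ◇ x ∈ proj₁ β

image : ∀ {x r u} {X : Set x} → Rel X r → Pred X u → Pred X (x ⊔ r ⊔ u)
image R U y = ∃ λ u → u ∈ U × R u y

perp : ∀ {x r u} {X : Set x} → Rel X r → Pred X u → Pred X (x ⊔ r ⊔ u)
perp _⊥_ U y = ∀ u → u ∈ U → y ⊥ u

singleton : ∀ {x} {X : Set x} → X → Pred X x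
singleton x y = x ≡ y

record IsMonadicOrthoframe {x r s} (X : Set x) (_⊥_ : Rel X r) (R : Rel X s) : Set (x ⊔ r ⊔ s) where
  field
    ⊥-irrefl : ∀ u → ¬ (u ⊥ u)
    ⊥-sym : ∀ {u v} → u ⊥ v → v ⊥ u
    R-refl : ∀ u → R u u
    R-trans : ∀ {u v w} → R u v → R v w → R u w
    monadic : ∀ u → image R (perp _⊥_ (image R (singleton u))) ⊆ perp _⊥_ (image R (singleton u))

-- In a bounded quasi-implication algebra every element is a complement, x = ~((0·x)·~x),
-- and from this the Boolean-like laws follow: x·x = 1 = 0·x, 1·x = x, ~~x = x and
-- contraposition. Hence ◇ is monotone and the dual operator □x = ~◇~x is monotone and
-- preserves the meet, so □⁻¹[δ] is a proper filter whenever δ is. Since □◇x = ◇x, every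
-- R-successor δ of u yields a second one, □⁻¹[δ]. If γ R β and γ is orthogonal to every
-- R-successor of u, a witness y of γ ⊥ □⁻¹[δ] gives ◇y ∈ β and ~◇y ∈ δ, i.e. β ⊥ δ.
module Submission where

open import Level using (Level)
open import Data.Product using (_,_; proj₁; proj₂)
open import Relation.Binary.PropositionalEquality
open import Relation.Nullary using (¬_)
open import Relation.Unary using (_∈_; _⊆_)
open import Defs

module BoundedQIAProperties {a} {A : Set a} (_·_ : A → A → A) (𝟘 : A)
                            (isBoundedQIA : IsBoundedQIA A _·_ 𝟘) where
  open IsBoundedQIA isBoundedQIA
  open IsQIA isQIA
  open ≡-Reasoning

  𝟙 : A
  𝟙 = 𝟘 · 𝟘

  infix 21 ~_
  ~_ : A → A
  ~ x = x · 𝟘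

  infix 4 _≤_
  _≤_ : A → A → Set a
  x ≤ y = x · y ≡ 𝟙

  _∧_ : A → A → A
  x ∧ y = ~ ((x · y) · ~ x)

  _∨_ : A → A → A
  x ∨ y = (~ x · ~ y) · x

  x·[x·y]≡x·y : ∀ x y → x · (x · y) ≡ x · y
  x·[x·y]≡x·y x y = trans (cong (_· (x · y)) (sym (ax1 x y))) (ax1 (x · y) x)

  ~w·~w≡𝟙 : ∀ w → ~ w · ~ w ≡ 𝟙
  ~w·~w≡𝟙 w = begin
    ~ w · ~ w                       ≡⟨ ax2 𝟘 w 𝟘 ⟨
    (𝟘 · w) · 𝟙                     ≡⟨ cong (_· 𝟙) (x·[x·y]≡x·y 𝟘 w) ⟨
    (𝟘 · (𝟘 · w)) · 𝟙               ≡⟨ ax2 𝟘 (𝟘 · w) 𝟘 ⟩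
    ~ (𝟘 · w) · ~ (𝟘 · w)           ≡⟨ cong₂ _·_ (ax1 𝟘 w) (ax1 𝟘 w) ⟩
    𝟙                               ∎

  x≡~[[𝟘·x]·~x] : ∀ x → x ≡ ~ ((𝟘 · x) · ~ x)
  x≡~[[𝟘·x]·~x] x = begin
    x                               ≡⟨ ax1 x x ⟨
    (x · x) · x                     ≡⟨ cong (_· x) (zero-imp x) ⟨
    (𝟘 · x) · x                     ≡⟨ cong (_· x) ~x·[𝟘·x]≡𝟘·x ⟨
    (~ x · (𝟘 · x)) · x             ≡⟨ ax3 x 𝟘 ⟩
    ~ ((𝟘 · x) · ~ x)               ∎
    where
    ~x·[𝟘·x]≡𝟘·x : ~ x · (𝟘 · x) ≡ 𝟘 · x
    ~x·[𝟘·x]≡𝟘·x = begin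
      ~ x · (𝟘 · x)                 ≡⟨ cong (~ x ·_) (zero-imp x) ⟩
      ~ x · (x · x)                 ≡⟨ ax2 𝟘 x x ⟨
      (𝟘 · x) · (𝟘 · x)             ≡⟨ zero-imp (𝟘 · x) ⟨
      𝟘 · (𝟘 · x)                   ≡⟨ x·[x·y]≡x·y 𝟘 x ⟩
      𝟘 · x                         ∎

  x·x≡𝟙 : ∀ x → x · x ≡ 𝟙
  x·x≡𝟙 x = trans (cong₂ _·_ x≡~w x≡~w) (~w·~w≡𝟙 _)
    where x≡~w = x≡~[[𝟘·x]·~x] x

  𝟘·x≡𝟙 : ∀ x → 𝟘 · x ≡ 𝟙
  𝟘·x≡𝟙 x = trans (zero-imp x) (x·x≡𝟙 x)

  𝟙·x≡x : ∀ x → 𝟙 · x ≡ x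
  𝟙·x≡x x = trans (cong (_· x) (sym (x·x≡𝟙 x))) (ax1 x x)

  x·𝟙≡𝟙 : ∀ x → x · 𝟙 ≡ 𝟙
  x·𝟙≡𝟙 x = trans (cong (x ·_) (sym (x·x≡𝟙 x))) (trans (x·[x·y]≡x·y x x) (x·x≡𝟙 x))

  ~~x≡x : ∀ x → ~ ~ x ≡ x
  ~~x≡x x = begin
    ~ ~ x                           ≡⟨ cong ~_ (𝟙·x≡x (~ x)) ⟨
    ~ (𝟙 · ~ x)                     ≡⟨ cong (λ t → ~ (t · ~ x)) (𝟘·x≡𝟙 x) ⟨
    ~ ((𝟘 · x) · ~ x)               ≡⟨ x≡~[[𝟘·x]·~x] x ⟨
    x                               ∎

  x∧~x≡𝟘 : ∀ x → x ∧ ~ x ≡ 𝟘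
  x∧~x≡𝟘 x = begin
    ~ ((x · ~ x) · ~ x)             ≡⟨ cong (λ t → ~ (t · ~ x)) (x·[x·y]≡x·y x 𝟘) ⟩
    ~ (~ x · ~ x)                   ≡⟨ cong ~_ (zero-imp (~ x)) ⟨
    ~ (𝟘 · ~ x)                     ≡⟨ ax1 𝟘 (~ x) ⟩
    𝟘                               ∎

  ~x≤x·y : ∀ x y → ~ x ≤ x · y
  ~x≤x·y x y = trans (sym (ax2 𝟘 x y)) (trans (cong₂ _·_ (𝟘·x≡𝟙 x) (𝟘·x≡𝟙 y)) (𝟙·x≡x 𝟙))

  ≤⇒≤·ʳ : ∀ {x y} → x ≤ y → x ≤ y · x
  ≤⇒≤·ʳ {x} {y} x≤y = begin
    x · (y · x)                     ≡⟨ 𝟙·x≡x _ ⟨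
    𝟙 · (x · (y · x))               ≡⟨ cong (_· (x · (y · x))) x≤y ⟨
    (x · y) · (x · (y · x))         ≡⟨ ax2 y x (y · x) ⟨
    (y · x) · (y · (y · x))         ≡⟨ cong ((y · x) ·_) (x·[x·y]≡x·y y x) ⟩
    (y · x) · (y · x)               ≡⟨ x·x≡𝟙 _ ⟩
    𝟙                               ∎

  ~-antitone : ∀ {x y} → x ≤ y → ~ y ≤ ~ x
  ~-antitone {x} {y} x≤y = begin
    ~ y · ~ x                       ≡⟨ cong (~ y ·_) ~x≡[y·x]·~y ⟩
    ~ y · ((y · x) · ~ y)           ≡⟨ ≤⇒≤·ʳ (~x≤x·y y x) ⟩
    𝟙                               ∎
    where
    ~x≡[y·x]·~y : ~ x ≡ (y · x) · ~ y
    ~x≡[y·x]·~y = begin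
      ~ x                           ≡⟨ 𝟙·x≡x _ ⟨
      𝟙 · ~ x                       ≡⟨ cong (_· ~ x) x≤y ⟨
      (x · y) · ~ x                 ≡⟨ ax2 x y 𝟘 ⟩
      (y · x) · ~ y                 ∎

  ∨-comm : ∀ x y → x ∨ y ≡ y ∨ x
  ∨-comm x y = begin
    (~ x · ~ y) · x                 ≡⟨ cong ((~ x · ~ y) ·_) (~~x≡x x) ⟨
    (~ x · ~ y) · ~ ~ x             ≡⟨ ax2 (~ x) (~ y) 𝟘 ⟩
    (~ y · ~ x) · ~ ~ y             ≡⟨ cong ((~ y · ~ x) ·_) (~~x≡x y) ⟩
    (~ y · ~ x) · y                 ∎

  y≤x∨y : ∀ x y → y ≤ x ∨ y
  y≤x∨y x y = trans (cong (y ·_) (∨-comm x y)) (≤⇒≤·ʳ y≤~y·~x)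
    where
    y≤~y·~x : y ≤ ~ y · ~ x
    y≤~y·~x = trans (cong (_· (~ y · ~ x)) (sym (~~x≡x y))) (~x≤x·y (~ y) (~ x))

  ≤⇒x∨y≡y : ∀ {x y} → x ≤ y → x ∨ y ≡ y
  ≤⇒x∨y≡y {x} {y} x≤y = trans (∨-comm x y) (trans (cong (_· y) (~-antitone x≤y)) (𝟙·x≡x y))

module FilterProperties {a} {A : Set a} {_·_ : A → A → A} {𝟘 : A}
                        (isBoundedQIA : IsBoundedQIA A _·_ 𝟘) where
  open BoundedQIAProperties _·_ 𝟘 isBoundedQIA

  module _ {ℓ} {α : A → Set ℓ} (isFilter : IsFilter _·_ 𝟘 α) where
    open IsFilter isFilter

    ≤-closed : ∀ {x y} → x ∈ α → x ≤ y → y ∈ α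
    ≤-closed x∈α x≤y = up x∈α (trans x≤y (sym (x·x≡𝟙 _)))

    𝟙∈ : 𝟙 ∈ α
    𝟙∈ = ≤-closed (proj₂ nonempty) (x·𝟙≡𝟙 _)

  x∈⇒~x∉ : ∀ {ℓ} {α : A → Set ℓ} → IsProperFilter _·_ 𝟘 α → ∀ {x} → x ∈ α → ¬ ~ x ∈ α
  x∈⇒~x∉ {α = α} isProper x∈α ~x∈α =
    proper (subst (_∈ α) (x∧~x≡𝟘 _) (IsFilter.meet isFilter x∈α ~x∈α))
    where open IsProperFilter isProper

module MonadicQIAProperties {a} {A : Set a} {_·_ : A → A → A} {𝟘 : A} {◇ : A → A}
                            (isMonadicQIA : IsMonadicQIA A _·_ 𝟘 ◇) where
  open IsMonadicQIA isMonadicQIA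
  open BoundedQIAProperties _·_ 𝟘 isBoundedQIA
  open ≡-Reasoning

  ◇-monotone : ∀ {x y} → x ≤ y → ◇ x ≤ ◇ y
  ◇-monotone {x} {y} x≤y = begin
    ◇ x · ◇ y                       ≡⟨ cong (λ t → ◇ x · ◇ t) (≤⇒x∨y≡y x≤y) ⟨
    ◇ x · ◇ (x ∨ y)                 ≡⟨ cong (◇ x ·_) (mc x y) ⟩
    ◇ x · (◇ x ∨ ◇ y)               ≡⟨ cong (◇ x ·_) (∨-comm (◇ x) (◇ y)) ⟩
    ◇ x · (◇ y ∨ ◇ x)               ≡⟨ y≤x∨y (◇ y) (◇ x) ⟩
    𝟙                               ∎

  x≤◇x : ∀ x → x ≤ ◇ x
  x≤◇x x = trans (ma2 x) (x·x≡𝟙 x)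

  ◇◇x≤◇x : ∀ x → ◇ (◇ x) ≤ ◇ x
  ◇◇x≤◇x x = trans (ma1 x) (x·x≡𝟙 x)

  □ : A → A
  □ x = ~ ◇ (~ x)

  □-monotone : ∀ {x y} → x ≤ y → □ x ≤ □ y
  □-monotone x≤y = ~-antitone (◇-monotone (~-antitone x≤y))

  □-∧ : ∀ x y → □ (x ∧ y) ≡ □ x ∧ □ y
  □-∧ x y = begin
    ~ ◇ (~ ~ ((x · y) · ~ x))       ≡⟨ cong (λ t → ~ ◇ t) (~~x≡x _) ⟩
    ~ ◇ ((x · y) · ~ x)             ≡⟨ cong (λ t → ~ ◇ ((t · y) · ~ x)) (~~x≡x x) ⟨
    ~ ◇ ((~ ~ x · y) · ~ x)         ≡⟨ cong (λ t → ~ ◇ ((~ ~ x · t) · ~ x)) (~~x≡x y) ⟨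
    ~ ◇ (~ x ∨ ~ y)                 ≡⟨ cong ~_ (mc (~ x) (~ y)) ⟩
    ~ ((□ x · □ y) · ◇ (~ x))       ≡⟨ cong (λ t → ~ ((□ x · □ y) · t)) (~~x≡x _) ⟨
    □ x ∧ □ y                       ∎

  ◇𝟙≡𝟙 : ◇ 𝟙 ≡ 𝟙
  ◇𝟙≡𝟙 = trans (sym (𝟙·x≡x (◇ 𝟙))) (x≤◇x 𝟙)

  □𝟘≡𝟘 : □ 𝟘 ≡ 𝟘
  □𝟘≡𝟘 = trans (cong ~_ ◇𝟙≡𝟙) (𝟙·x≡x 𝟘)

  □𝟙≡𝟙 : □ 𝟙 ≡ 𝟙
  □𝟙≡𝟙 = trans (cong (λ t → ~ ◇ t) (𝟙·x≡x 𝟘)) (cong ~_ mb2)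

  □◇x≡◇x : ∀ x → □ (◇ x) ≡ ◇ x
  □◇x≡◇x x = trans (cong ~_ (mb1 x)) (~~x≡x (◇ x))

  □-preimage : ∀ {ℓ} → ProperFilters ℓ _·_ 𝟘 → ProperFilters ℓ _·_ 𝟘
  □-preimage (δ , isProper) = (λ x → □ x ∈ δ) , record
    { isFilter = record
      { nonempty = 𝟙 , subst (_∈ δ) (sym □𝟙≡𝟙) (𝟙∈ isFilter)
      ; up       = λ □x∈δ x·y≡y·y → ≤-closed isFilter □x∈δ (□-monotone (trans x·y≡y·y (x·x≡𝟙 _)))
      ; meet     = λ □x∈δ □y∈δ → subst (_∈ δ) (sym (□-∧ _ _)) (meet □x∈δ □y∈δ)
      }
    ; proper = λ □𝟘∈δ → proper (subst (_∈ δ) □𝟘≡𝟘 □𝟘∈δ)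
    }
    where
    open IsProperFilter isProper
    open IsFilter isFilter
    open FilterProperties isBoundedQIA

module FilterFrame {a} (ℓ : Level) {A : Set a} {_·_ : A → A → A} {𝟘 : A} {◇ : A → A}
                      (isMonadicQIA : IsMonadicQIA A _·_ 𝟘 ◇) where
  open IsMonadicQIA isMonadicQIA
  open BoundedQIAProperties _·_ 𝟘 isBoundedQIA
  open FilterProperties isBoundedQIA
  open MonadicQIAProperties isMonadicQIA

  𝔉 : Set _
  𝔉 = ProperFilters ℓ _·_ 𝟘

  _⊥_ : 𝔉 → 𝔉 → Set _
  _⊥_ = ⊥ᴳ ℓ _·_ 𝟘

  _R_ : 𝔉 → 𝔉 → Set _
  _R_ = Rᴳ ℓ _·_ 𝟘 ◇

  isFilterOf : (α : 𝔉) → IsFilter _·_ 𝟘 (proj₁ α)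
  isFilterOf α = IsProperFilter.isFilter (proj₂ α)

  ⊥-irrefl : ∀ α → ¬ α ⊥ α
  ⊥-irrefl α (x , x∈α , ~x∈α) = x∈⇒~x∉ (proj₂ α) x∈α ~x∈α

  ⊥-sym : ∀ {α β} → α ⊥ β → β ⊥ α
  ⊥-sym {α} (x , x∈α , ~x∈β) = ~ x , ~x∈β , subst (_∈ proj₁ α) (sym (~~x≡x x)) x∈α

  R-refl : ∀ α → α R α
  R-refl α x∈α = ≤-closed (isFilterOf α) x∈α (x≤◇x _)

  R-trans : ∀ {α β γ} → α R β → β R γ → α R γ
  R-trans {γ = γ} αRβ βRγ x∈α = ≤-closed (isFilterOf γ) (βRγ (αRβ x∈α)) (◇◇x≤◇x _)

  R⇒R-□-preimage : ∀ {α δ} → α R δ → α R □-preimage δ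
  R⇒R-□-preimage {δ = δ} αRδ {x} x∈α = subst (_∈ proj₁ δ) (sym (□◇x≡◇x x)) (αRδ x∈α)

  ⊥-□-preimage-transfer : ∀ {γ β δ} → γ R β → γ ⊥ □-preimage δ → β ⊥ δ
  ⊥-□-preimage-transfer {δ = δ} γRβ (y , y∈γ , □~y∈δ) =
    ◇ y , γRβ y∈γ , subst (_∈ proj₁ δ) (cong (λ t → ~ ◇ t) (~~x≡x y)) □~y∈δ

  R-monadic : ∀ u → image _R_ (perp _⊥_ (image _R_ (singleton u))) ⊆ perp _⊥_ (image _R_ (singleton u))
  R-monadic u {β} (γ , γ⊥R[u] , γRβ) δ (_ , refl , uRδ) =
    ⊥-□-preimage-transfer {γ} {β} {δ} γRβ (γ⊥R[u] (□-preimage δ) (u , refl , R⇒R-□-preimage {u} {δ} uRδ))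

theorem5p9 : ∀ {a} (ℓ : Level) (A : Set a) (_·_ : A → A → A) (𝟘 : A) (◇ : A → A)
    → IsMonadicQIA A _·_ 𝟘 ◇
    → IsMonadicOrthoframe (ProperFilters ℓ _·_ 𝟘) (⊥ᴳ ℓ _·_ 𝟘) (Rᴳ ℓ _·_ 𝟘 ◇)
-- ⊥ᴳ and Rᴳ only see the carriers of filters, so the filters themselves are passed explicitly.
theorem5p9 ℓ A _·_ 𝟘 ◇ isMonadicQIA = record
  { ⊥-irrefl = ⊥-irrefl
  ; ⊥-sym    = λ {α β} → ⊥-sym {α} {β}
  ; R-refl   = R-refl
  ; R-trans  = λ {α β γ} → R-trans {α} {β} {γ}
  ; monadic  = R-monadic
  }
  where open FilterFrame ℓ isMonadicQIA
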